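{- Let $r \ge 2$ and $s_1 \ge s_2 \ge \cdots \ge s_r \ge 1$ be integers, and let $K_{s_1, s_2, \ldots, s_r}$ be the complete $r$-partite graph with vertex classes of sizes $s_1, \ldots, s_r$. Then $$\gamma(K_{s_1, s_2, \ldots, s_r}) = 4s_1 + 2s_2 + 2s_3 + \cdots + 2s_r - 3.$$
   Context: A configuration on a graph $G$ is a function $C: V(G) \to \{0,1,2,\dots\}$ (the number of pebbles on each vertex); its size is $\sum_{v} C(v)$. A pebbling move removes two pebbles from some vertex and places one pebble on an adjacent vertex. A configuration is cover-solvable if, by a sequence of pebbling moves, one can reach a configuration with at least one pebble on every vertex simultaneously. The cover pebbling number $\gamma(G)$ of a connected graph $G$ is the smallest integer $k$ such that every configuration of size $k$ on $G$ is cover-solvable. -}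

module Defs where

open import Data.Nat using (ℕ; zero; suc; _+_; _*_; _∸_; _≤_; _<_)
open import Data.Fin using (Fin; zero; suc; splitAt; _≟_)
open import Data.Vec using (Vec; []; _∷_)
import Data.Vec as Vec
open import Data.List using (map)
open import Data.Nat.ListAction using (sum)
open import Data.List.Base using (allFin)
open import Data.Sum using (inj₁; inj₂)
open import Data.Product using (Σ; ∃; ∃-syntax; _×_; _,_)
open import Relation.Nullary using (¬_; yes; no)
open import Relation.Binary.PropositionalEquality using (_≡_; _≢_)
open import Relation.Binary.Construct.Closure.ReflexiveTransitive using (Star)

Graph : ℕ → Set₁
Graph n = Fin n → Fin n → Set

Config : ℕ → Set
Config n = Fin n → ℕ

size : ∀ {n} → Config n → ℕ
size {n} C = sum (map C (allFin n))

afterMove : ∀ {n} → Config n → Fin n → Fin n → Config n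
afterMove C u v w =
  (case-u (w ≟ u)) + (case-v (w ≟ v))
  where
  case-u : _ → ℕ
  case-u (yes _) = C u ∸ 2
  case-u (no _)  = C w
  case-v : _ → ℕ
  case-v (yes _) = 1
  case-v (no _)  = 0

Move : ∀ {n} → Graph n → Config n → Config n → Set
Move {n} G C D = Σ (Fin n) λ u → Σ (Fin n) λ v →
  G u v × 2 ≤ C u × (∀ w → D w ≡ afterMove C u v w)

Reachable : ∀ {n} → Graph n → Config n → Config n → Set
Reachable G = Star (Move G)

CoverSolvable : ∀ {n} → Graph n → Config n → Set
CoverSolvable {n} G C = ∃[ D ] (Reachable G C D × (∀ v → 1 ≤ D v))

IsCoverPebblingNumber : ∀ {n} → Graph n → ℕ → Set
IsCoverPebblingNumber {n} G k =
  (∀ (C : Config n) → size C ≡ k → CoverSolvable G C) ×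
  (∀ j → j < k → ¬ (∀ (C : Config n) → size C ≡ j → CoverSolvable G C))

-- Complete multipartite graph with class sizes s = (s₁,…,s_r):
-- vertex set Fin (s₁ + … + s_r), split consecutively into classes.
classOf : ∀ {r} (s : Vec ℕ r) → Fin (Vec.sum s) → Fin r
classOf (x ∷ s) i with splitAt x i
... | inj₁ _ = zero
... | inj₂ j = suc (classOf s j)

CompleteMultipartite : ∀ {r} (s : Vec ℕ r) → Graph (Vec.sum s)
CompleteMultipartite s u v = classOf s u ≢ classOf s v

formula : ∀ {r} → Vec ℕ r → ℕ
formula [] = 0
formula (x ∷ xs) = 4 * x + 2 * Vec.sum xs ∸ 3

-- Lower bound: fix a vertex v₀ of a largest class and weigh each vertex w by
-- 2 ^ d(v₀, w).  A pebbling move never increases the weighted pebble count,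
-- a covering configuration has weighted count at least Σ_w 2 ^ d(v₀, w), which
-- is the claimed value γ, and γ − 1 pebbles stacked on v₀ have weighted count
-- γ − 1.
--
-- Upper bound: let H be the number of empty vertices and U = Σ_w ⌊(C w − 1)/2⌋
-- the total surplus.  Counting shows that a configuration of size γ satisfies
-- H + min(H, s₁ − 1) ≤ U.  While H > 0, either some vertex with three pebbles
-- lies in a different class from some empty vertex and fills it directly (H
-- and U drop by one), or all such vertices lie in the one class containing all
-- empty vertices, so that H ≤ s₁ − 1; then two moves into a vertex of another
-- class followed by one move out of it fill a hole (H drops by one, U by two).
-- Both steps preserve the inequality.
module Submission where

open import Defs
open import Data.Nat using (ℕ; _≤_)
open import Data.Fin using (Fin)
import Data.Fin as F
open import Data.Vec using (Vec; lookup)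

open import Data.Nat
  using (zero; suc; _+_; _*_; _∸_; _^_; _<_; _⊓_; z≤n; s≤s; s≤s⁻¹)
import Data.Nat as ℕ
open import Data.Nat.Properties hiding (_≟_)
open import Data.Nat.Tactic.RingSolver using (solve)
import Data.Nat.ListAction as ListAction
open import Data.Fin using (zero; suc; _≟_; _↑ˡ_; _↑ʳ_; punchIn)
open import Data.Fin.Properties
  using (punchInᵢ≢i; splitAt-↑ˡ; splitAt-↑ʳ; any?)
import Data.Vec as Vec
open import Data.Vec.Functional using (updateAt; replicate)
open import Data.Vec.Functional.Properties using (updateAt-updates; updateAt-minimal)
import Data.List.Base as List
open import Data.List.Base using ([]; _∷_)
open import Data.List.Properties using (map-tabulate)
open import Algebra.Properties.Semiring.Sum +-*-semiring
  using (sum; sum-cong-≗; ∑-distrib-+; *-distribˡ-sum; sum-remove)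
open import Algebra.Properties.CommutativeSemigroup +-commutativeSemigroup
  using (xy∙z≈zy∙x; xy∙z≈xz∙y)
open import Data.Bool.Base using (if_then_else_)
open import Data.Product using (∃; ∃-syntax; _×_; _,_; proj₂)
open import Function.Base using (_∘_; const)
open import Relation.Nullary using (¬_; Dec; yes; no; does; contradiction)
open import Relation.Nullary.Decidable using (decidable-stable; _×-dec_; ¬?)
open import Relation.Binary.PropositionalEquality
  using (_≡_; _≢_; _≗_; refl; sym; trans; cong; cong₂; subst; subst₂; module ≡-Reasoning)
open import Relation.Binary.Construct.Closure.ReflexiveTransitive using (ε; _◅_; _◅◅_)

-- Finite sums

𝟙 : {P : Set} → Dec P → ℕ
𝟙 d = if does d then 1 else 0

𝟙-yes : {P : Set} (d : Dec P) → P → 𝟙 d ≡ 1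
𝟙-yes (yes _) _  = refl
𝟙-yes (no ¬p) p  = contradiction p ¬p

𝟙-no : {P : Set} (d : Dec P) → ¬ P → 𝟙 d ≡ 0
𝟙-no (yes p) ¬p = contradiction p ¬p
𝟙-no (no _)  _  = refl

𝟙-positive : {P : Set} (d : Dec P) → 1 ≤ 𝟙 d → P
𝟙-positive (yes p) _ = p

sum-const : ∀ n k → sum {n} (const k) ≡ n * k
sum-const zero    k = refl
sum-const (suc n) k = cong (k +_) (sum-const n k)

sum-mono-≤ : ∀ {n} {f g : Fin n → ℕ} → (∀ i → f i ≤ g i) → sum f ≤ sum g
sum-mono-≤ {zero}  _   = z≤n
sum-mono-≤ {suc n} f≤g = +-mono-≤ (f≤g zero) (sum-mono-≤ (f≤g ∘ suc))

≤-sum : ∀ {n} (f : Fin n → ℕ) i → f i ≤ sum f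
≤-sum f zero    = m≤m+n _ _
≤-sum f (suc i) = ≤-trans (≤-sum (f ∘ suc) i) (m≤n+m _ _)

sum-positive : ∀ {n} (f : Fin n → ℕ) → 1 ≤ sum f → ∃ λ i → 1 ≤ f i
sum-positive {suc n} f 1≤Σf with f zero in f₀≡
... | suc _ = zero , subst (1 ≤_) (sym f₀≡) (s≤s z≤n)
... | zero  = let i , 1≤fi = sum-positive (f ∘ suc) 1≤Σf in suc i , 1≤fi

sum-≗-except : ∀ {n} {f g : Fin n → ℕ} i → (∀ j → j ≢ i → f j ≡ g j) →
  sum f + g i ≡ sum g + f i
sum-≗-except {suc n} {f} {g} i f≡g = begin
  sum f + g i                     ≡⟨ cong (_+ g i) (sum-remove {i = i} f) ⟩
  f i + sum (f ∘ punchIn i) + g i ≡⟨ cong (λ t → f i + t + g i) (sum-cong-≗ f≡g-punched) ⟩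
  f i + sum (g ∘ punchIn i) + g i ≡⟨ xy∙z≈zy∙x (f i) _ (g i) ⟩
  g i + sum (g ∘ punchIn i) + f i ≡⟨ cong (_+ f i) (sum-remove {i = i} g) ⟨
  sum g + f i                     ∎
  where
  open ≡-Reasoning
  f≡g-punched : ∀ j → f (punchIn i j) ≡ g (punchIn i j)
  f≡g-punched j = f≡g (punchIn i j) (punchInᵢ≢i i j)

sum-concentrated : ∀ {n} {f : Fin n → ℕ} i → (∀ j → j ≢ i → f j ≡ 0) → sum f ≡ f i
sum-concentrated {n} {f} i f≡0 = begin
  sum f                    ≡⟨ +-identityʳ _ ⟨
  sum f + 0                ≡⟨ sum-≗-except i f≡0 ⟩
  sum {n} (const 0) + f i  ≡⟨ cong (_+ f i) (trans (sum-const n 0) (*-zeroʳ n)) ⟩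
  f i                      ∎
  where open ≡-Reasoning

sum-𝟙-≟ : ∀ {n} (v : Fin n) → sum (λ w → 𝟙 (w ≟ v)) ≡ 1
sum-𝟙-≟ v = trans (sum-concentrated v λ w w≢v → 𝟙-no (w ≟ v) w≢v) (𝟙-yes (v ≟ v) refl)

sum-↑ : ∀ m {k} (f : Fin (m + k) → ℕ) → sum f ≡ sum (f ∘ (_↑ˡ k)) + sum (f ∘ (m ↑ʳ_))
sum-↑ zero    f = refl
sum-↑ (suc m) f = trans (cong (f zero +_) (sum-↑ m (f ∘ suc))) (sym (+-assoc (f zero) _ _))

sum-tabulate : ∀ {n} (f : Fin n → ℕ) → ListAction.sum (List.tabulate f) ≡ sum f
sum-tabulate {zero}  f = refl
sum-tabulate {suc n} f = cong (f zero +_) (sum-tabulate (f ∘ suc))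

size≡sum : ∀ {n} (C : Config n) → size C ≡ sum C
size≡sum C = trans (cong ListAction.sum (map-tabulate (λ i → i) C)) (sum-tabulate C)

-- Pebbling moves and potentials

potential : ∀ {n} → (Fin n → ℕ → ℕ) → Config n → ℕ
potential F C = sum λ w → F w (C w)

potential-updateAt : ∀ {n} (F : Fin n → ℕ → ℕ) (C : Config n) i (f : ℕ → ℕ) →
  potential F (updateAt C i f) + F i (C i) ≡ potential F C + F i (f (C i))
potential-updateAt F C i f =
  trans (sum-≗-except i λ j j≢i → cong (F j) (updateAt-minimal j i C j≢i))
        (cong (λ c → potential F C + F i c) (updateAt-updates i C))

afterMove-updateAt : ∀ {n} (C : Config n) {u v} → u ≢ v →
  afterMove C u v ≗ updateAt (updateAt C u (_∸ 2)) v suc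
afterMove-updateAt C {u} {v} u≢v w with w ≟ u | w ≟ v
... | yes refl | yes refl = contradiction refl u≢v
... | yes refl | no w≢v   =
  trans (+-identityʳ _) (sym (trans (updateAt-minimal w v _ w≢v) (updateAt-updates w C)))
... | no w≢u   | yes refl =
  trans (+-comm (C w) 1) (sym (trans (updateAt-updates w _) (cong suc (updateAt-minimal w u C w≢u))))
... | no w≢u   | no w≢v   =
  trans (+-identityʳ _) (sym (trans (updateAt-minimal w v _ w≢v) (updateAt-minimal w u C w≢u)))

module _ {n} (C : Config n) {u v : Fin n} (u≢v : u ≢ v) where

  afterMove-away : ∀ {w} → w ≢ v → afterMove C u v w ≡ updateAt C u (_∸ 2) w
  afterMove-away {w} w≢v = trans (afterMove-updateAt C u≢v w) (updateAt-minimal w v _ w≢v)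

  afterMove-other : ∀ {w} → w ≢ u → w ≢ v → afterMove C u v w ≡ C w
  afterMove-other {w} w≢u w≢v = trans (afterMove-away w≢v) (updateAt-minimal w u C w≢u)

  afterMove-target : afterMove C u v v ≡ suc (C v)
  afterMove-target = trans (afterMove-updateAt C u≢v v)
    (trans (updateAt-updates v _) (cong suc (updateAt-minimal v u C (u≢v ∘ sym))))

  potential-afterMove : (F : Fin n → ℕ → ℕ) →
    potential F (afterMove C u v) + F u (C u) + F v (C v) ≡
    potential F C + F u (C u ∸ 2) + F v (suc (C v))
  potential-afterMove F = begin
    potential F (afterMove C u v) + F u (C u) + F v (C v)
      ≡⟨ cong (λ t → t + F u (C u) + F v (C v))
              (sum-cong-≗ λ w → cong (F w) (afterMove-updateAt C u≢v w)) ⟩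
    potential F (updateAt E v suc) + F u (C u) + F v (C v)
      ≡⟨ xy∙z≈xz∙y (potential F (updateAt E v suc)) (F u (C u)) (F v (C v)) ⟩
    potential F (updateAt E v suc) + F v (C v) + F u (C u)
      ≡⟨ cong (λ c → potential F (updateAt E v suc) + F v c + F u (C u)) Ev≡Cv ⟨
    potential F (updateAt E v suc) + F v (E v) + F u (C u)
      ≡⟨ cong (_+ F u (C u)) (potential-updateAt F E v suc) ⟩
    potential F E + F v (suc (E v)) + F u (C u)
      ≡⟨ xy∙z≈xz∙y (potential F E) (F v (suc (E v))) (F u (C u)) ⟩
    potential F E + F u (C u) + F v (suc (E v))
      ≡⟨ cong₂ (λ t c → t + F v (suc c)) (potential-updateAt F C u (_∸ 2)) Ev≡Cv ⟩
    potential F C + F u (C u ∸ 2) + F v (suc (C v))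
      ∎
    where
    open ≡-Reasoning
    E : Config n
    E = updateAt C u (_∸ 2)
    Ev≡Cv : E v ≡ C v
    Ev≡Cv = updateAt-minimal v u C (u≢v ∘ sym)

move : ∀ {n} {G : Graph n} (C : Config n) {u v} → G u v → 2 ≤ C u → Move G C (afterMove C u v)
move C uv 2≤Cu = _ , _ , uv , 2≤Cu , λ _ → refl

stack : ∀ {n} → Fin n → ℕ → Config n
stack {n} v j = updateAt (replicate n 0) v (const j)

size-stack : ∀ {n} (v : Fin n) j → size (stack v j) ≡ j
size-stack v j = trans (size≡sum (stack v j))
  (trans (sum-concentrated v λ w w≢v → updateAt-minimal w v _ w≢v) (updateAt-updates v _))

weight-after-move-≤ : ∀ {W W′ a b c d} → 2 ≤ c → b ≤ 2 * a →
  W′ + c * a + d * b ≡ W + (c ∸ 2) * a + suc d * b → W′ ≤ W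
weight-after-move-≤ {W} {W′} {a} {b} {suc (suc c)} {d} (s≤s (s≤s _)) b≤2a eq =
  +-cancelʳ-≤ (2 * a) W′ W (begin
    W′ + 2 * a ≡⟨ +-cancelʳ-≡ (c * a + d * b) _ _ balance ⟩
    W + b      ≤⟨ +-monoʳ-≤ W b≤2a ⟩
    W + 2 * a  ∎)
  where
  open ≤-Reasoning
  balance : W′ + 2 * a + (c * a + d * b) ≡ W + b + (c * a + d * b)
  balance = begin-equality
    W′ + 2 * a + (c * a + d * b)   ≡⟨ solve (W′ ∷ a ∷ c ∷ d ∷ b ∷ []) ⟩
    W′ + suc (suc c) * a + d * b   ≡⟨ eq ⟩
    W + c * a + suc d * b          ≡⟨ solve (W ∷ a ∷ c ∷ d ∷ b ∷ []) ⟩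
    W + b + (c * a + d * b)        ∎

module WeightBound {n} (G : Graph n) (G-irrefl : ∀ {u} → ¬ G u u)
                   (ω : Fin n → ℕ) (ω-edge : ∀ {u v} → G u v → ω v ≤ 2 * ω u) where

  weight : Config n → ℕ
  weight = potential λ w c → c * ω w

  weight-move : ∀ {C D} → Move G C D → weight D ≤ weight C
  weight-move {C} {D} (u , v , uv , 2≤Cu , D≗) = weight-after-move-≤ {d = C v} 2≤Cu (ω-edge uv) (begin
    weight D + C u * ω u + C v * ω v
      ≡⟨ cong (λ t → t + C u * ω u + C v * ω v) (sum-cong-≗ λ w → cong (_* ω w) (D≗ w)) ⟩
    weight (afterMove C u v) + C u * ω u + C v * ω v
      ≡⟨ potential-afterMove C u≢v (λ w c → c * ω w) ⟩
    weight C + (C u ∸ 2) * ω u + suc (C v) * ω v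
      ∎)
    where
    open ≡-Reasoning
    u≢v : u ≢ v
    u≢v refl = G-irrefl uv

  weight-reach : ∀ {C D} → Reachable G C D → weight D ≤ weight C
  weight-reach ε        = ≤-refl
  weight-reach (m ◅ ms) = ≤-trans (weight-reach ms) (weight-move m)

  weight-covered : ∀ {D} → (∀ w → 1 ≤ D w) → sum ω ≤ weight D
  weight-covered {D} covered = sum-mono-≤ λ w →
    subst (_≤ D w * ω w) (*-identityˡ (ω w)) (*-monoˡ-≤ (ω w) (covered w))

  weight-stack : ∀ v j → weight (stack v j) ≡ j * ω v
  weight-stack v j = trans
    (sum-concentrated v λ w w≢v → cong (_* ω w) (updateAt-minimal w v _ w≢v))
    (cong (_* ω v) (updateAt-updates v _))

  notAllCoverSolvable : ∀ {v₀} → ω v₀ ≡ 1 → ∀ j → j < sum ω →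
    ¬ (∀ (C : Config n) → size C ≡ j → CoverSolvable G C)
  notAllCoverSolvable {v₀} ωv₀≡1 j j<Σω allSolvable
    with allSolvable (stack v₀ j) (size-stack v₀ j)
  ... | D , stack⇝D , covered = <⇒≱ j<Σω (begin
    sum ω                ≤⟨ weight-covered covered ⟩
    weight D             ≤⟨ weight-reach stack⇝D ⟩
    weight (stack v₀ j)  ≡⟨ weight-stack v₀ j ⟩
    j * ω v₀             ≡⟨ cong (j *_) ωv₀≡1 ⟩
    j * 1                ≡⟨ *-identityʳ j ⟩
    j                    ∎)
    where open ≤-Reasoning

-- Holes and surplus

gap : ℕ → ℕ
gap zero    = 1
gap (suc _) = 0

-- surplus c = ⌊(c ∸ 1) / 2⌋: the number of moves a vertex holding c pebbles
-- can make while keeping a pebble for itself.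
surplus : ℕ → ℕ
surplus (suc (suc (suc c))) = suc (surplus (suc c))
surplus _                   = 0

gap-pos : ∀ {c} → 1 ≤ c → gap c ≡ 0
gap-pos (s≤s _) = refl

1≤gap⇒≡0 : ∀ {c} → 1 ≤ gap c → c ≡ 0
1≤gap⇒≡0 {zero}  _  = refl
1≤gap⇒≡0 {suc _} ()

gap≤0⇒1≤ : ∀ {c} → gap c ≤ 0 → 1 ≤ c
gap≤0⇒1≤ {zero}  ()
gap≤0⇒1≤ {suc _} _ = s≤s z≤n

gap-≤-𝟙 : ∀ {c} {P : Set} (d : Dec P) → (c ≡ 0 → P) → gap c ≤ 𝟙 d
gap-≤-𝟙 {zero}  d p = ≤-reflexive (sym (𝟙-yes d (p refl)))
gap-≤-𝟙 {suc _} d _ = z≤n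

surplus-∸2 : ∀ {c} → 3 ≤ c → surplus c ≡ suc (surplus (c ∸ 2))
surplus-∸2 (s≤s (s≤s (s≤s _))) = refl

1≤surplus⇒3≤ : ∀ {c} → 1 ≤ surplus c → 3 ≤ c
1≤surplus⇒3≤ {suc (suc (suc _))} _ = s≤s (s≤s (s≤s z≤n))
1≤surplus⇒3≤ {zero}              ()
1≤surplus⇒3≤ {suc zero}          ()
1≤surplus⇒3≤ {suc (suc zero)}    ()

pebbles≤surplus : ∀ c → c + 2 * gap c ≤ 2 * surplus c + 2
pebbles≤surplus zero                = ≤-refl
pebbles≤surplus (suc zero)          = s≤s z≤n
pebbles≤surplus (suc (suc zero))    = ≤-refl
pebbles≤surplus (suc (suc (suc c))) =
  subst (suc (suc (suc c)) + 0 ≤_) (cong (_+ 2) (sym (*-suc 2 (surplus (suc c)))))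
    (s≤s (s≤s (pebbles≤surplus (suc c))))

holes : ∀ {n} → Config n → ℕ
holes = potential λ _ → gap

totalSurplus : ∀ {n} → Config n → ℕ
totalSurplus = potential λ _ → surplus

hole : ∀ {n} (C : Config n) → 1 ≤ holes C → ∃ λ h → C h ≡ 0
hole C 1≤H = let h , 1≤gap = sum-positive (gap ∘ C) 1≤H in h , 1≤gap⇒≡0 1≤gap

source : ∀ {n} (C : Config n) → 1 ≤ totalSurplus C → ∃ λ u → 3 ≤ C u
source C 1≤U = let u , 1≤surplus = sum-positive (surplus ∘ C) 1≤U in u , 1≤surplus⇒3≤ 1≤surplus

covered-of-no-holes : ∀ {n} (C : Config n) → holes C ≡ 0 → ∀ w → 1 ≤ C w
covered-of-no-holes C H≡0 w = gap≤0⇒1≤ (subst (gap (C w) ≤_) H≡0 (≤-sum (gap ∘ C) w))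

empty≢loaded : ∀ {n} {C : Config n} {h u} → C h ≡ 0 → 3 ≤ C u → h ≢ u
empty≢loaded Ch≡0 3≤Cu refl with () ← subst (3 ≤_) Ch≡0 3≤Cu

size+holes≤surplus : ∀ {n} (C : Config n) → size C + 2 * holes C ≤ 2 * totalSurplus C + 2 * n
size+holes≤surplus {n} C = begin
  size C + 2 * holes C                        ≡⟨ cong₂ _+_ (size≡sum C) (*-distribˡ-sum 2 (gap ∘ C)) ⟩
  sum C + sum (λ w → 2 * gap (C w))           ≡⟨ ∑-distrib-+ C (λ w → 2 * gap (C w)) ⟨
  sum (λ w → C w + 2 * gap (C w))             ≤⟨ sum-mono-≤ (pebbles≤surplus ∘ C) ⟩
  sum (λ w → 2 * surplus (C w) + 2)           ≡⟨ ∑-distrib-+ (λ w → 2 * surplus (C w)) (const 2) ⟩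
  sum (λ w → 2 * surplus (C w)) + sum {n} (const 2)
    ≡⟨ cong₂ _+_ (*-distribˡ-sum 2 (surplus ∘ C)) (sym (trans (sum-const n 2) (*-comm n 2))) ⟨
  2 * totalSurplus C + 2 * n                  ∎
  where open ≤-Reasoning

totalSurplus-remove : ∀ {n} (C : Config n) {u} → 3 ≤ C u →
  totalSurplus C ≡ suc (totalSurplus (updateAt C u (_∸ 2)))
totalSurplus-remove {n} C {u} 3≤Cu = +-cancelʳ-≡ (surplus (C u ∸ 2)) _ _ (begin
  totalSurplus C + surplus (C u ∸ 2)       ≡⟨ potential-updateAt (λ _ → surplus) C u (_∸ 2) ⟨
  totalSurplus E + surplus (C u)           ≡⟨ cong (totalSurplus E +_) (surplus-∸2 3≤Cu) ⟩
  totalSurplus E + suc (surplus (C u ∸ 2)) ≡⟨ +-suc _ _ ⟩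
  suc (totalSurplus E) + surplus (C u ∸ 2) ∎)
  where
  open ≡-Reasoning
  E : Config n
  E = updateAt C u (_∸ 2)

updateAt-∸-≤ : ∀ {n} (C : Config n) u k w → updateAt C u (_∸ k) w ≤ C w
updateAt-∸-≤ C u k w with w ≟ u
... | yes refl = subst (_≤ C w) (sym (updateAt-updates w C)) (m∸n≤m (C w) k)
... | no w≢u   = ≤-reflexive (updateAt-minimal w u C w≢u)

twoSources : ∀ {n} (C : Config n) → 2 ≤ totalSurplus C →
  ∃ λ u₁ → ∃ λ u₂ → 3 ≤ C u₁ × 3 ≤ updateAt C u₁ (_∸ 2) u₂
twoSources C 2≤U =
  let u₁ , 3≤Cu₁ = source C (<⇒≤ 2≤U)
      u₂ , 3≤Eu₂ = source (updateAt C u₁ (_∸ 2))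
                          (s≤s⁻¹ (subst (2 ≤_) (totalSurplus-remove C 3≤Cu₁) 2≤U))
  in u₁ , u₂ , 3≤Cu₁ , 3≤Eu₂

module _ {n} (C : Config n) {u v : Fin n} (u≢v : u ≢ v) (3≤Cu : 3 ≤ C u) where

  private
    D : Config n
    D = afterMove C u v

  holes-afterMove : holes C ≡ holes (afterMove C u v) + gap (C v)
  holes-afterMove = begin
    holes C                                   ≡⟨ +-identityʳ _ ⟨
    holes C + 0                               ≡⟨ cong (holes C +_) (gap-pos (∸-monoˡ-≤ 2 3≤Cu)) ⟨
    holes C + gap (C u ∸ 2)                   ≡⟨ +-identityʳ _ ⟨
    holes C + gap (C u ∸ 2) + gap (suc (C v)) ≡⟨ potential-afterMove C u≢v (λ _ → gap) ⟨
    holes D + gap (C u) + gap (C v)           ≡⟨ cong (λ g → holes D + g + gap (C v)) (gap-pos 1≤Cu) ⟩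
    holes D + 0 + gap (C v)                   ≡⟨ cong (_+ gap (C v)) (+-identityʳ _) ⟩
    holes D + gap (C v)                       ∎
    where
    open ≡-Reasoning
    1≤Cu : 1 ≤ C u
    1≤Cu = ≤-trans (s≤s z≤n) 3≤Cu

  totalSurplus-afterMove :
    totalSurplus C + surplus (suc (C v)) ≡ totalSurplus (afterMove C u v) + suc (surplus (C v))
  totalSurplus-afterMove = +-cancelʳ-≡ (surplus (C u ∸ 2)) _ _ (begin
    totalSurplus C + surplus (suc (C v)) + surplus (C u ∸ 2)
      ≡⟨ xy∙z≈xz∙y (totalSurplus C) (surplus (suc (C v))) (surplus (C u ∸ 2)) ⟩
    totalSurplus C + surplus (C u ∸ 2) + surplus (suc (C v))
      ≡⟨ potential-afterMove C u≢v (λ _ → surplus) ⟨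
    totalSurplus D + surplus (C u) + surplus (C v)
      ≡⟨ cong (λ s → totalSurplus D + s + surplus (C v)) (surplus-∸2 3≤Cu) ⟩
    totalSurplus D + suc (surplus (C u ∸ 2)) + surplus (C v)
      ≡⟨ xy∙z≈xz∙y (totalSurplus D) (suc (surplus (C u ∸ 2))) (surplus (C v)) ⟩
    totalSurplus D + surplus (C v) + suc (surplus (C u ∸ 2))
      ≡⟨ +-suc (totalSurplus D + surplus (C v)) (surplus (C u ∸ 2)) ⟩
    suc (totalSurplus D + surplus (C v)) + surplus (C u ∸ 2)
      ≡⟨ cong (_+ surplus (C u ∸ 2)) (+-suc (totalSurplus D) (surplus (C v))) ⟨
    totalSurplus D + suc (surplus (C v)) + surplus (C u ∸ 2)
      ∎)
    where open ≡-Reasoning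

  module _ (Cv≡0 : C v ≡ 0) where

    holes-fill : holes C ≡ suc (holes (afterMove C u v))
    holes-fill = trans holes-afterMove
      (trans (cong (λ c → holes D + gap c) Cv≡0) (+-comm (holes D) 1))

    totalSurplus-fill : totalSurplus C ≡ suc (totalSurplus (afterMove C u v))
    totalSurplus-fill = begin
      totalSurplus C                       ≡⟨ +-identityʳ _ ⟨
      totalSurplus C + surplus 1           ≡⟨ cong (λ c → totalSurplus C + surplus (suc c)) Cv≡0 ⟨
      totalSurplus C + surplus (suc (C v)) ≡⟨ totalSurplus-afterMove ⟩
      totalSurplus D + suc (surplus (C v)) ≡⟨ cong (λ c → totalSurplus D + suc (surplus c)) Cv≡0 ⟩
      totalSurplus D + 1                   ≡⟨ +-comm _ 1 ⟩
      suc (totalSurplus D)                 ∎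
      where open ≡-Reasoning

-- Filling a hole costs one unit of surplus by a direct move and two by a
-- relay, and relays are only forced once at most K holes remain.
Affordable : ∀ {n} → ℕ → Config n → Set
Affordable K C = holes C + holes C ⊓ K ≤ totalSurplus C

budget-direct : ∀ K {h u} → suc h + suc h ⊓ K ≤ suc u → h + h ⊓ K ≤ u
budget-direct K {h} p = s≤s⁻¹ (≤-trans (+-monoʳ-≤ (suc h) (⊓-monoˡ-≤ K (n≤1+n h))) p)

budget-relay : ∀ K {h u} → suc h ≤ K → suc h + suc h ⊓ K ≤ 2 + u → h + h ⊓ K ≤ u
budget-relay K {h} {u} h<K p = begin
  h + h ⊓ K  ≤⟨ +-monoʳ-≤ h (m⊓n≤m h K) ⟩
  h + h      ≤⟨ s≤s⁻¹ (s≤s⁻¹ 2+h+h≤2+u) ⟩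
  u          ∎
  where
  open ≤-Reasoning
  2+h+h≤2+u : 2 + (h + h) ≤ 2 + u
  2+h+h≤2+u = begin
    2 + (h + h)        ≡⟨ cong suc (+-suc h h) ⟨
    suc h + suc h      ≡⟨ cong (suc h +_) (m≤n⇒m⊓n≡m h<K) ⟨
    suc h + suc h ⊓ K  ≤⟨ p ⟩
    2 + u              ∎

budget-≥2 : ∀ K {h u} → 1 ≤ h → h ≤ K → h + h ⊓ K ≤ u → 2 ≤ u
budget-≥2 K {h} 1≤h h≤K p =
  ≤-trans (+-mono-≤ 1≤h (subst (1 ≤_) (sym (m≤n⇒m⊓n≡m h≤K)) 1≤h)) p

budget-of-size : ∀ n K {H U S} → 2 * n + 2 * K ≤ S + 1 → S + 2 * H ≤ 2 * U + 2 * n → K + H ≤ U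
budget-of-size n K {H} {U} {S} bound pebbles =
  s≤s⁻¹ (*-cancelˡ-< 2 (K + H) (suc U) (+-cancelˡ-≤ (2 * n) _ _ (begin
    2 * n + suc (2 * (K + H))  ≡⟨ solve (n ∷ K ∷ H ∷ []) ⟩
    2 * n + 2 * K + 2 * H + 1  ≤⟨ +-monoˡ-≤ 1 (+-monoˡ-≤ (2 * H) bound) ⟩
    S + 1 + 2 * H + 1          ≡⟨ solve (S ∷ H ∷ []) ⟩
    S + 2 * H + 2              ≤⟨ +-monoˡ-≤ 2 pebbles ⟩
    2 * U + 2 * n + 2          ≡⟨ solve (U ∷ n ∷ []) ⟩
    2 * n + 2 * suc U          ∎)))
  where open ≤-Reasoning

affordable-of-size : ∀ {n} K (C : Config n) → 2 * n + 2 * K ≤ size C + 1 → Affordable K C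
affordable-of-size {n} K C bound = begin
  holes C + holes C ⊓ K  ≤⟨ +-monoʳ-≤ (holes C) (m⊓n≤n (holes C) K) ⟩
  holes C + K            ≡⟨ +-comm (holes C) K ⟩
  K + holes C            ≤⟨ budget-of-size n K bound (size+holes≤surplus C) ⟩
  totalSurplus C         ∎
  where open ≤-Reasoning

-- Complete multipartite graphs

module Multipartite {n r} (cl : Fin n → Fin r) where

  G : Graph n
  G u v = cl u ≢ cl v

  G-irrefl : ∀ {u} → ¬ G u u
  G-irrefl u↮u = u↮u refl

  G⇒≢ : ∀ {u v} → G u v → u ≢ v
  G⇒≢ u↮v refl = G-irrefl u↮v

  classSize : Fin r → ℕ
  classSize c = sum λ w → 𝟙 (cl w ≟ c)

  vertexOutside : ∀ {c c′} → c′ ≢ c → 1 ≤ classSize c′ → ∃ λ w → cl w ≢ c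
  vertexOutside {c′ = c′} c′≢c 1≤|c′| =
    let w , 1≤𝟙 = sum-positive _ 1≤|c′| in w , c′≢c ∘ trans (sym (𝟙-positive (cl w ≟ c′) 1≤𝟙))

  holes<classSize : ∀ {C : Config n} {c u} → (∀ w → C w ≡ 0 → cl w ≡ c) → 3 ≤ C u → cl u ≡ c →
    suc (holes C) ≤ classSize c
  holes<classSize {C} {c} {u} holes∈c 3≤Cu u∈c = begin
    suc (holes C)                       ≡⟨ cong (_+ holes C) (sum-𝟙-≟ u) ⟨
    sum (λ w → 𝟙 (w ≟ u)) + holes C     ≡⟨ ∑-distrib-+ (λ w → 𝟙 (w ≟ u)) (gap ∘ C) ⟨
    sum (λ w → 𝟙 (w ≟ u) + gap (C w))   ≤⟨ sum-mono-≤ pointwise ⟩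
    classSize c                         ∎
    where
    open ≤-Reasoning
    pointwise : ∀ w → 𝟙 (w ≟ u) + gap (C w) ≤ 𝟙 (cl w ≟ c)
    pointwise w with w ≟ u
    ... | yes refl = ≤-reflexive (trans (cong suc (gap-pos (≤-trans (s≤s z≤n) 3≤Cu)))
                                        (sym (𝟙-yes (cl w ≟ c) u∈c)))
    ... | no _     = gap-≤-𝟙 (cl w ≟ c) (holes∈c w)

  module UpperBound (K : ℕ) (classSize≤ : ∀ c → classSize c ≤ suc K)
                    (outside : ∀ c → ∃ λ w → cl w ≢ c) where

    Progress : Config n → Set
    Progress C = ∃[ D ] (Reachable G C D × holes C ≡ suc (holes D) × Affordable K D)

    fill-direct : ∀ {C : Config n} {h u} → Affordable K C → C h ≡ 0 → 3 ≤ C u → G u h → Progress C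
    fill-direct {C} {h} {u} aff Ch≡0 3≤Cu u↮h =
      afterMove C u h , move C u↮h (<⇒≤ 3≤Cu) ◅ ε , holes-fill C u≢h 3≤Cu Ch≡0 ,
      budget-direct K (subst₂ (λ H U → H + H ⊓ K ≤ U)
                              (holes-fill C u≢h 3≤Cu Ch≡0) (totalSurplus-fill C u≢h 3≤Cu Ch≡0) aff)
      where
      u≢h : u ≢ h
      u≢h = G⇒≢ u↮h

    -- w passes on the two pebbles it receives, so the relay costs exactly two
    -- units of surplus although it makes three moves.
    module Relay {C : Config n} {h w u₁ u₂ : Fin n}
                 (Ch≡0 : C h ≡ 0) (1≤Cw : 1 ≤ C w) (w↮h : G w h)
                 (u₁∼h : cl u₁ ≡ cl h) (u₂∼h : cl u₂ ≡ cl h)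
                 (3≤Cu₁ : 3 ≤ C u₁) (3≤Eu₂ : 3 ≤ updateAt C u₁ (_∸ 2) u₂) where

      C₁ C₂ C₃ : Config n
      C₁ = afterMove C u₁ w
      C₂ = afterMove C₁ u₂ w
      C₃ = afterMove C₂ w h

      u₁↮w : G u₁ w
      u₁↮w u₁∼w = w↮h (trans (sym u₁∼w) u₁∼h)

      u₂↮w : G u₂ w
      u₂↮w u₂∼w = w↮h (trans (sym u₂∼w) u₂∼h)

      3≤C₁u₂ : 3 ≤ C₁ u₂
      3≤C₁u₂ = subst (3 ≤_) (sym (afterMove-away C (G⇒≢ u₁↮w) (G⇒≢ u₂↮w))) 3≤Eu₂

      C₁w : C₁ w ≡ suc (C w)
      C₁w = afterMove-target C (G⇒≢ u₁↮w)

      3≤C₂w : 3 ≤ C₂ w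
      3≤C₂w = subst (3 ≤_) (sym (trans (afterMove-target C₁ (G⇒≢ u₂↮w)) (cong suc C₁w))) (s≤s (s≤s 1≤Cw))

      C₁h : C₁ h ≡ 0
      C₁h = trans (afterMove-other C (G⇒≢ u₁↮w) (empty≢loaded Ch≡0 3≤Cu₁) (G⇒≢ w↮h ∘ sym)) Ch≡0

      C₂h : C₂ h ≡ 0
      C₂h = trans (afterMove-other C₁ (G⇒≢ u₂↮w) (empty≢loaded C₁h 3≤C₁u₂) (G⇒≢ w↮h ∘ sym)) C₁h

      relay-reach : Reachable G C C₃
      relay-reach = move C u₁↮w (<⇒≤ 3≤Cu₁) ◅ move C₁ u₂↮w (<⇒≤ 3≤C₁u₂) ◅ move C₂ w↮h (<⇒≤ 3≤C₂w) ◅ ε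

      relay-holes : holes C ≡ suc (holes C₃)
      relay-holes = begin
        holes C               ≡⟨ holes-afterMove C (G⇒≢ u₁↮w) 3≤Cu₁ ⟩
        holes C₁ + gap (C w)  ≡⟨ cong (holes C₁ +_) (gap-pos 1≤Cw) ⟩
        holes C₁ + 0          ≡⟨ +-identityʳ _ ⟩
        holes C₁              ≡⟨ holes-afterMove C₁ (G⇒≢ u₂↮w) 3≤C₁u₂ ⟩
        holes C₂ + gap (C₁ w) ≡⟨ cong (λ c → holes C₂ + gap c) C₁w ⟩
        holes C₂ + 0          ≡⟨ +-identityʳ _ ⟩
        holes C₂              ≡⟨ holes-fill C₂ (G⇒≢ w↮h) 3≤C₂w C₂h ⟩
        suc (holes C₃)        ∎
        where open ≡-Reasoning

      relay-surplus : totalSurplus C ≡ 2 + totalSurplus C₃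
      relay-surplus = begin
        totalSurplus C         ≡⟨ +-cancelʳ-≡ (surplus (suc (C w))) _ _ first-two-moves ⟩
        suc (totalSurplus C₂)  ≡⟨ cong suc (totalSurplus-fill C₂ (G⇒≢ w↮h) 3≤C₂w C₂h) ⟩
        2 + totalSurplus C₃    ∎
        where
        open ≡-Reasoning
        first-two-moves : totalSurplus C + surplus (suc (C w)) ≡ suc (totalSurplus C₂) + surplus (suc (C w))
        first-two-moves = begin
          totalSurplus C + surplus (suc (C w))
            ≡⟨ totalSurplus-afterMove C (G⇒≢ u₁↮w) 3≤Cu₁ ⟩
          totalSurplus C₁ + suc (surplus (C w))
            ≡⟨ cong (totalSurplus C₁ +_) (surplus-∸2 (s≤s (s≤s 1≤Cw))) ⟨
          totalSurplus C₁ + surplus (2 + C w)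
            ≡⟨ cong (λ c → totalSurplus C₁ + surplus (suc c)) C₁w ⟨
          totalSurplus C₁ + surplus (suc (C₁ w))
            ≡⟨ totalSurplus-afterMove C₁ (G⇒≢ u₂↮w) 3≤C₁u₂ ⟩
          totalSurplus C₂ + suc (surplus (C₁ w))
            ≡⟨ cong (λ c → totalSurplus C₂ + suc (surplus c)) C₁w ⟩
          totalSurplus C₂ + suc (surplus (suc (C w)))
            ≡⟨ +-suc _ _ ⟩
          suc (totalSurplus C₂) + surplus (suc (C w))
            ∎

    holes≤K : ∀ {C : Config n} {u} → (∀ h u → C h ≡ 0 → 3 ≤ C u → cl u ≡ cl h) → 3 ≤ C u → holes C ≤ K
    holes≤K {C} {u} sameClass 3≤Cu = s≤s⁻¹ (≤-trans
      (holes<classSize (λ w Cw≡0 → sym (sameClass w u Cw≡0 3≤Cu)) 3≤Cu refl) (classSize≤ (cl u)))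

    fill-by-relay : ∀ {C : Config n} → 1 ≤ holes C → Affordable K C →
      (∀ h u → C h ≡ 0 → 3 ≤ C u → cl u ≡ cl h) → Progress C
    fill-by-relay {C} 1≤H aff sameClass = relay (hole C 1≤H) (twoSources C 2≤U)
      where
      H≤K : holes C ≤ K
      H≤K = holes≤K sameClass (proj₂ (source C (≤-trans 1≤H (≤-trans (m≤m+n _ _) aff))))
      2≤U : 2 ≤ totalSurplus C
      2≤U = budget-≥2 K 1≤H H≤K aff
      relay : (∃ λ h → C h ≡ 0) → (∃ λ u₁ → ∃ λ u₂ → 3 ≤ C u₁ × 3 ≤ updateAt C u₁ (_∸ 2) u₂) → Progress C
      relay (h , Ch≡0) (u₁ , u₂ , 3≤Cu₁ , 3≤Eu₂) with outside (cl h)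
      ... | w , w↮h =
        C₃ , relay-reach , relay-holes ,
        budget-relay K (subst (_≤ K) relay-holes H≤K)
                       (subst₂ (λ H U → H + H ⊓ K ≤ U) relay-holes relay-surplus aff)
        where
        1≤Cw : 1 ≤ C w
        1≤Cw = n≢0⇒n>0 λ Cw≡0 → w↮h (trans (sym (sameClass w u₁ Cw≡0 3≤Cu₁)) (sameClass h u₁ Ch≡0 3≤Cu₁))
        open Relay Ch≡0 1≤Cw w↮h (sameClass h u₁ Ch≡0 3≤Cu₁)
                   (sameClass h u₂ Ch≡0 (≤-trans 3≤Eu₂ (updateAt-∸-≤ C u₁ 2 u₂))) 3≤Cu₁ 3≤Eu₂

    progress : ∀ {C : Config n} → 1 ≤ holes C → Affordable K C → Progress C
    progress {C} 1≤H aff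
      with any? (λ h → any? (λ u → (C h ℕ.≟ 0) ×-dec (3 ≤? C u) ×-dec ¬? (cl u ≟ cl h)))
    ... | yes (h , u , Ch≡0 , 3≤Cu , u↮h) = fill-direct aff Ch≡0 3≤Cu u↮h
    ... | no noDirectMove = fill-by-relay 1≤H aff λ h u Ch≡0 3≤Cu →
      decidable-stable (cl u ≟ cl h) λ u↮h → noDirectMove (h , u , Ch≡0 , 3≤Cu , u↮h)

    coverSolvable-of-affordable : ∀ k (C : Config n) → holes C ≡ k → Affordable K C → CoverSolvable G C
    coverSolvable-of-affordable zero C H≡0 _ = C , ε , covered-of-no-holes C H≡0
    coverSolvable-of-affordable (suc k) C H≡1+k aff
      with progress (subst (1 ≤_) (sym H≡1+k) (s≤s z≤n)) aff
    ... | D , C⇝D , H≡1+HD , affD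
      with coverSolvable-of-affordable k D (suc-injective (trans (sym H≡1+HD) H≡1+k)) affD
    ... | E , D⇝E , covered = E , C⇝D ◅◅ D⇝E , covered

    coverSolvable-of-size : ∀ (C : Config n) → 2 * n + 2 * K ≤ size C + 1 → CoverSolvable G C
    coverSolvable-of-size C bound = coverSolvable-of-affordable _ C refl (affordable-of-size K C bound)

  distance : Fin n → Fin n → ℕ
  distance v₀ w with w ≟ v₀ | cl w ≟ cl v₀
  ... | yes _ | _     = 0
  ... | no _  | no _  = 1
  ... | no _  | yes _ = 2

  distance-self : ∀ v₀ → distance v₀ v₀ ≡ 0
  distance-self v₀ with v₀ ≟ v₀ | cl v₀ ≟ cl v₀
  ... | yes _    | _ = refl
  ... | no v₀≢v₀ | _ = contradiction refl v₀≢v₀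

  distance≤2 : ∀ v₀ w → distance v₀ w ≤ 2
  distance≤2 v₀ w with w ≟ v₀ | cl w ≟ cl v₀
  ... | yes _ | _     = z≤n
  ... | no _  | no _  = s≤s z≤n
  ... | no _  | yes _ = ≤-refl

  distance-neighbour : ∀ {v₀ w} → G w v₀ → distance v₀ w ≡ 1
  distance-neighbour {v₀} {w} w↮v₀ with w ≟ v₀ | cl w ≟ cl v₀
  ... | yes refl | _       = contradiction refl w↮v₀
  ... | no _     | no _    = refl
  ... | no _     | yes w∼v₀ = contradiction w∼v₀ w↮v₀

  distance-edge : ∀ v₀ {u v} → G u v → distance v₀ v ≤ suc (distance v₀ u)
  distance-edge v₀ {u} {v} u↮v with u ≟ v₀ | cl u ≟ cl v₀
  ... | yes refl | _     = ≤-reflexive (distance-neighbour (u↮v ∘ sym))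
  ... | no _     | no _  = distance≤2 v₀ v
  ... | no _     | yes _ = ≤-trans (distance≤2 v₀ v) (n≤1+n 2)

  weightFrom : Fin n → Fin n → ℕ
  weightFrom v₀ w = 2 ^ distance v₀ w

  weightFrom-edge : ∀ v₀ {u v} → G u v → weightFrom v₀ v ≤ 2 * weightFrom v₀ u
  weightFrom-edge v₀ u↮v = ^-monoʳ-≤ 2 (distance-edge v₀ u↮v)

  weightFrom-pointwise : ∀ v₀ w → weightFrom v₀ w + 3 * 𝟙 (w ≟ v₀) ≡ 2 + 2 * 𝟙 (cl w ≟ cl v₀)
  weightFrom-pointwise v₀ w with w ≟ v₀ | cl w ≟ cl v₀
  ... | yes refl | yes _    = refl
  ... | yes refl | no ¬refl  = contradiction refl ¬refl
  ... | no _     | yes _    = refl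
  ... | no _     | no _     = refl

  sum-weightFrom : ∀ v₀ → sum (weightFrom v₀) + 3 ≡ 2 * n + 2 * classSize (cl v₀)
  sum-weightFrom v₀ = begin
    sum ω + 3                                     ≡⟨ cong (λ t → sum ω + 3 * t) (sum-𝟙-≟ v₀) ⟨
    sum ω + 3 * sum (λ w → 𝟙 (w ≟ v₀))            ≡⟨ cong (sum ω +_) (*-distribˡ-sum 3 (𝟙 ∘ (_≟ v₀))) ⟩
    sum ω + sum (λ w → 3 * 𝟙 (w ≟ v₀))            ≡⟨ ∑-distrib-+ ω (λ w → 3 * 𝟙 (w ≟ v₀)) ⟨
    sum (λ w → ω w + 3 * 𝟙 (w ≟ v₀))              ≡⟨ sum-cong-≗ (weightFrom-pointwise v₀) ⟩
    sum (λ w → 2 + 2 * 𝟙 (cl w ≟ cl v₀))          ≡⟨ ∑-distrib-+ (const 2) (λ w → 2 * same w) ⟩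
    sum {n} (const 2) + sum (λ w → 2 * same w)
      ≡⟨ cong₂ _+_ (trans (sum-const n 2) (*-comm n 2)) (sym (*-distribˡ-sum 2 same)) ⟩
    2 * n + 2 * classSize (cl v₀)                 ∎
    where
    open ≡-Reasoning
    ω same : Fin n → ℕ
    ω = weightFrom v₀
    same w = 𝟙 (cl w ≟ cl v₀)

  isCoverPebblingNumber : ∀ {K γ} v₀ → classSize (cl v₀) ≡ suc K → (∀ c → classSize c ≤ suc K) →
    (∀ c → ∃ λ w → cl w ≢ c) → γ + 1 ≡ 2 * n + 2 * K → IsCoverPebblingNumber G γ
  isCoverPebblingNumber {K} {γ} v₀ |v₀|≡1+K classSize≤ outside γ+1≡ =
      (λ C size≡γ → coverSolvable-of-size C (≤-reflexive (trans (sym γ+1≡) (cong (_+ 1) (sym size≡γ)))))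
    , λ j j<γ → notAllCoverSolvable {v₀} (cong (2 ^_) (distance-self v₀)) j (subst (j <_) γ≡Σω j<γ)
    where
    open UpperBound K classSize≤ outside
    open WeightBound G G-irrefl (weightFrom v₀) (weightFrom-edge v₀)
    γ≡Σω : γ ≡ sum (weightFrom v₀)
    γ≡Σω = +-cancelʳ-≡ 3 _ _ (begin
      γ + 3                          ≡⟨ solve (γ ∷ []) ⟩
      γ + 1 + 2                      ≡⟨ cong (_+ 2) γ+1≡ ⟩
      2 * n + 2 * K + 2              ≡⟨ solve (n ∷ K ∷ []) ⟩
      2 * n + 2 * suc K              ≡⟨ cong (λ k → 2 * n + 2 * k) |v₀|≡1+K ⟨
      2 * n + 2 * classSize (cl v₀)  ≡⟨ sum-weightFrom v₀ ⟨
      sum (weightFrom v₀) + 3        ∎)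
      where open ≡-Reasoning

classOf-↑ˡ : ∀ {r} x (s : Vec ℕ r) i → classOf (x Vec.∷ s) (i ↑ˡ Vec.sum s) ≡ zero
classOf-↑ˡ x s i rewrite splitAt-↑ˡ x i (Vec.sum s) = refl

classOf-↑ʳ : ∀ {r} x (s : Vec ℕ r) j → classOf (x Vec.∷ s) (x ↑ʳ j) ≡ suc (classOf s j)
classOf-↑ʳ x s j rewrite splitAt-↑ʳ x (Vec.sum s) j = refl

classSize-classOf : ∀ {r} (s : Vec ℕ r) c → Multipartite.classSize (classOf s) c ≡ lookup s c
classSize-classOf (x Vec.∷ s) c = begin
  classSize (classOf (x Vec.∷ s)) c
    ≡⟨ sum-↑ x (λ w → 𝟙 (classOf (x Vec.∷ s) w ≟ c)) ⟩
  sum (λ i → 𝟙 (classOf (x Vec.∷ s) (i ↑ˡ Vec.sum s) ≟ c)) +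
  sum (λ j → 𝟙 (classOf (x Vec.∷ s) (x ↑ʳ j) ≟ c))
    ≡⟨ cong₂ _+_ (sum-cong-≗ λ i → cong (λ c′ → 𝟙 (c′ ≟ c)) (classOf-↑ˡ x s i))
                 (sum-cong-≗ λ j → cong (λ c′ → 𝟙 (c′ ≟ c)) (classOf-↑ʳ x s j)) ⟩
  sum {x} (const (𝟙 (zero ≟ c))) + sum (λ j → 𝟙 (suc (classOf s j) ≟ c))
    ≡⟨ byClass c ⟩
  lookup (x Vec.∷ s) c
    ∎
  where
  open ≡-Reasoning
  open Multipartite using (classSize)
  byClass : ∀ c → sum {x} (const (𝟙 (zero ≟ c))) + sum (λ j → 𝟙 (suc (classOf s j) ≟ c)) ≡
                  lookup (x Vec.∷ s) c
  byClass zero    = trans (cong₂ _+_ (trans (sum-const x 1) (*-identityʳ x))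
                                     (trans (sum-const (Vec.sum s) 0) (*-zeroʳ (Vec.sum s))))
                          (+-identityʳ x)
  byClass (suc c) = trans (cong (_+ classSize (classOf s) c) (trans (sum-const x 0) (*-zeroʳ x)))
                          (classSize-classOf s c)

formula+1 : ∀ x m → 4 * suc x + 2 * m ∸ 3 + 1 ≡ 2 * (suc x + m) + 2 * x
formula+1 x m = begin
  4 * suc x + 2 * m ∸ 3 + 1        ≡⟨ cong (λ t → t ∸ 3 + 1) split3 ⟩
  3 + (4 * x + 2 * m + 1) ∸ 3 + 1  ≡⟨ cong (_+ 1) (m+n∸m≡n 3 _) ⟩
  4 * x + 2 * m + 1 + 1            ≡⟨ solve (x ∷ m ∷ []) ⟩
  2 * (suc x + m) + 2 * x          ∎
  where
  open ≡-Reasoning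
  split3 : 4 * suc x + 2 * m ≡ 3 + (4 * x + 2 * m + 1)
  split3 = solve (x ∷ m ∷ [])

mainTheorem1 : (r : ℕ) → 2 ≤ r → (s : Vec ℕ r) →
    (∀ (i j : Fin r) → i F.≤ j → lookup s j ≤ lookup s i) →
    (∀ (i : Fin r) → 1 ≤ lookup s i) →
    IsCoverPebblingNumber (CompleteMultipartite s) (formula s)
mainTheorem1 (suc zero) (s≤s ()) _ _ _
mainTheorem1 (suc (suc r)) _ (zero Vec.∷ _) _ positive = contradiction (positive zero) λ ()
mainTheorem1 (suc (suc r)) _ s@(suc x Vec.∷ s′) decreasing positive =
  isCoverPebblingNumber zero (classSize-classOf s zero) largest outside (formula+1 x (Vec.sum s′))
  where
  open Multipartite (classOf s)
  largest : ∀ c → classSize c ≤ suc x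
  largest c = subst (_≤ suc x) (sym (classSize-classOf s c)) (decreasing zero c z≤n)
  outside : ∀ c → ∃ λ w → classOf s w ≢ c
  outside c = vertexOutside (punchInᵢ≢i c zero)
                (subst (1 ≤_) (sym (classSize-classOf s (punchIn c zero))) (positive (punchIn c zero)))
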